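{- Let $G$ be a $3$-connected graph with at least six vertices and an edge $e=uv$, and suppose $G$ has a vertex $w$ such that $\{u,v,w\}$ is a vertex-cut of $G$ and each connected component of $G-\{u,v,w\}$ is a tree containing exactly one neighbor of $w$. Then $G$ has no prism-minor using $e$.
   Context: Graphs are finite, without loops or parallel edges. The prism is two disjoint triangles joined by a perfect matching. A minor $H$ of $G$ uses the edge $uv$ if $H$ has an edge $ab$ such that each of $a,b$ is either in $\{u,v\}$ or is obtained by identifying (via contractions) a set of vertices meeting $\{u,v\}$. -}

module Defs where

open import Data.Nat using (ℕ; _≤_; _<_)
open import Data.Fin using (Fin; toℕ)
open import Data.Maybe using (Maybe; just)
open import Data.Product using (Σ; ∃; ∃-syntax; _×_; _,_)
open import Data.Sum using (_⊎_; inj₁; inj₂)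
open import Data.Unit using (⊤)
open import Data.List using (List; _∷_; []; length; _++_)
open import Data.List.Relation.Unary.All using (All)
open import Data.List.Relation.Unary.Any as Any using (Any)
open import Data.List.Relation.Unary.Unique.Propositional using (Unique)
open import Data.List.Relation.Unary.Linked using (Linked)
open import Relation.Nullary using (¬_)
open import Relation.Binary.PropositionalEquality using (_≡_; _≢_)

record Graph (n : ℕ) : Set₁ where
  field
    Adj    : Fin n → Fin n → Set
    sym    : ∀ {x y} → Adj x y → Adj y x
    irrefl : ∀ {x} → ¬ Adj x x
open Graph public

module _ {n : ℕ} (G : Graph n) where

  data Reach (P : Fin n → Set) : Fin n → Fin n → Set where
    here : ∀ {x} → P x → Reach P x x
    step : ∀ {x y z} → P x → Adj G x y → Reach P y z → Reach P x z

  ConnectedOn : (Fin n → Set) → Set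
  ConnectedOn P = ∀ x y → P x → P y → Reach P x y

  HasCycle : (Fin n → Set) → Set
  HasCycle P = Σ (Fin n) λ x → Σ (List (Fin n)) λ rest →
    (2 ≤ length rest) × Unique (x ∷ rest) × All P (x ∷ rest)
      × Linked (Adj G) (x ∷ rest ++ (x ∷ []))

  IsTree : (Fin n → Set) → Set
  IsTree P = (∃ λ x → P x) × ConnectedOn P × ¬ HasCycle P

  ThreeConnected : Set
  ThreeConnected = (3 < n) × ConnectedOn (λ _ → ⊤)
    × (∀ a b → ConnectedOn (λ x → x ≢ a × x ≢ b))

  Outside3 : Fin n → Fin n → Fin n → Fin n → Set
  Outside3 a b c x = x ≢ a × x ≢ b × x ≢ c

  VertexCut3 : Fin n → Fin n → Fin n → Set
  VertexCut3 a b c = ¬ ConnectedOn (Outside3 a b c)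

  Component3 : Fin n → Fin n → Fin n → Fin n → Fin n → Set
  Component3 a b c x = Reach (Outside3 a b c) x

  -- A model of a minor H in G: each vertex of G is mapped to at most one
  -- vertex of H (disjoint branch sets); each branch set is nonempty and
  -- induces a connected subgraph; every edge of H is realised by an edge of G
  -- between the corresponding branch sets.
  record MinorModel {k : ℕ} (H : Graph k) : Set₁ where
    field
      φ         : Fin n → Maybe (Fin k)
      nonempty  : ∀ a → ∃ λ x → φ x ≡ just a
      connected : ∀ a → ConnectedOn (λ x → φ x ≡ just a)
      edges     : ∀ a b → Adj H a b →
                  ∃ λ x → ∃ λ y → Adj G x y × φ x ≡ just a × φ y ≡ just b
  open MinorModel public

  -- The minor (given by model M) uses the edge uv: H has an edge ab such that
  -- both branch sets of a and b meet {u, v}; by disjointness this means one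
  -- contains u and the other contains v.
  UsesEdge : {k : ℕ} {H : Graph k} → MinorModel H → Fin n → Fin n → Set
  UsesEdge {H = H} M u v = ∃ λ a → ∃ λ b → Adj H a b
    × (φ M u ≡ just a) × (φ M v ≡ just b)

prismEdges : List (ℕ × ℕ)
prismEdges = (0 , 1) ∷ (1 , 2) ∷ (0 , 2) ∷ (3 , 4) ∷ (4 , 5) ∷ (3 , 5)
           ∷ (0 , 3) ∷ (1 , 4) ∷ (2 , 5) ∷ []

PrismAdj : Fin 6 → Fin 6 → Set
PrismAdj i j = Any (_≡ (toℕ i , toℕ j)) prismEdges ⊎ Any (_≡ (toℕ j , toℕ i)) prismEdges

private
  noDiag : ∀ k → ¬ Any (_≡ (k , k)) prismEdges
  noDiag k (Any.here ())
  noDiag k (Any.there (Any.here ()))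
  noDiag k (Any.there (Any.there (Any.here ())))
  noDiag k (Any.there (Any.there (Any.there (Any.here ()))))
  noDiag k (Any.there (Any.there (Any.there (Any.there (Any.here ())))))
  noDiag k (Any.there (Any.there (Any.there (Any.there (Any.there (Any.here ()))))))
  noDiag k (Any.there (Any.there (Any.there (Any.there (Any.there (Any.there (Any.here ())))))))
  noDiag k (Any.there (Any.there (Any.there (Any.there (Any.there (Any.there (Any.there (Any.here ()))))))))
  noDiag k (Any.there (Any.there (Any.there (Any.there (Any.there (Any.there (Any.there (Any.there (Any.here ())))))))))
  noDiag k (Any.there (Any.there (Any.there (Any.there (Any.there (Any.there (Any.there (Any.there (Any.there ())))))))))

  prismSym : ∀ {i j} → PrismAdj i j → PrismAdj j i
  prismSym (inj₁ p) = inj₂ p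
  prismSym (inj₂ p) = inj₁ p

  prismIrrefl : ∀ {i} → ¬ PrismAdj i i
  prismIrrefl {i} (inj₁ p) = noDiag (toℕ i) p
  prismIrrefl {i} (inj₂ p) = noDiag (toℕ i) p

Prism : Graph 6
Prism = record { Adj = PrismAdj ; sym = prismSym ; irrefl = prismIrrefl }

HasPrismMinorUsing : {n : ℕ} → Graph n → Fin n → Fin n → Set₁
HasPrismMinorUsing G u v = Σ (MinorModel G Prism) λ M → UsesEdge G M u v

-- Deleting u and v from G leaves w together with trees, each joined to w by a
-- single edge, so G − {u, v} is a forest.
-- A prism-minor using uv puts u and v into the branch sets of adjacent prism
-- vertices a and b, and Prism − {a, b} still contains a cycle. The branch sets
-- of that cycle avoid u and v, so they would carry a cycle of G − {u, v}.
module Submission where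

open import Defs
open import Data.Nat using (ℕ; _≤_; s≤s; z≤n) renaming (_≟_ to _≟ℕ_)
open import Data.Nat.Properties using (suc-injective)
open import Data.Fin using (Fin; toℕ) renaming (_≟_ to _≟F_)
open import Data.Fin.Properties using (any?; all?)
open import Data.Product using (∃; _×_; _,_; proj₁; proj₂)
open import Data.Product.Properties using (≡-dec)
open import Data.Sum using (_⊎_; inj₁; inj₂)
open import Data.Empty using (⊥; ⊥-elim)
open import Data.Maybe using (just)
open import Data.Maybe.Properties using (just-injective)
open import Data.List using (List; []; _∷_; _++_; _∷ʳ_; [_]; length; initLast; InitLast)
open InitLast using (_∷ʳ′_)
open import Data.List.Properties using (++-assoc)
open import Data.List.Relation.Unary.All as All using (All; []; _∷_)
open import Data.List.Relation.Unary.All.Properties using (¬Any⇒All¬) renaming (++⁺ to All-++⁺; ++⁻ˡ to All-++⁻ˡ)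
open import Data.List.Relation.Unary.Any using (here; there) renaming (any? to anyᴸ?)
open import Data.List.Membership.Propositional using (_∈_; _∉_)
open import Data.List.Membership.Propositional.Properties using (∈-++⁺ʳ; ∈-∃++)
import Data.List.Membership.DecPropositional as DecMembership
open import Data.List.Relation.Unary.Unique.Propositional using (Unique)
open import Data.List.Relation.Unary.Unique.Propositional.Properties using () renaming (++⁺ to Unique-++⁺)
open import Data.List.Relation.Unary.AllPairs using ([]; _∷_)
open import Data.List.Relation.Unary.Linked as Linked using (Linked; [-]; _∷_)
open import Data.List.Relation.Binary.Permutation.Propositional using (_↭_; ↭⇒↭ₛ)
open import Data.List.Relation.Binary.Permutation.Propositional.Properties using (++-comm; ↭-length; All-resp-↭)
import Data.List.Relation.Binary.Permutation.Setoid.Properties as Permutationₛ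
open import Relation.Nullary using (¬_; Dec; yes; no)
open import Relation.Nullary.Decidable using (toWitness; _×-dec_; _⊎-dec_; _→-dec_; ¬?)
open import Relation.Binary.PropositionalEquality
  using (_≡_; _≢_; refl; trans; subst; ≢-sym; setoid)
  renaming (sym to ≡-sym)

module _ {a ℓ} {A : Set a} {R : A → A → Set ℓ} where

  Linked-split : ∀ xs {y ys} → Linked R (xs ++ y ∷ ys) → Linked R (xs ∷ʳ y) × Linked R (y ∷ ys)
  Linked-split []             l       = [-] , l
  Linked-split (_ ∷ [])       (r ∷ l) = r ∷ [-] , l
  Linked-split (_ ∷ x′ ∷ xs)  (r ∷ l) with before , after ← Linked-split (x′ ∷ xs) l = r ∷ before , after

  Linked-join : ∀ xs {y ys} → Linked R (xs ∷ʳ y) → Linked R (y ∷ ys) → Linked R (xs ++ y ∷ ys)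
  Linked-join []            _         l = l
  Linked-join (_ ∷ [])      (r ∷ [-]) l = r ∷ l
  Linked-join (_ ∷ x′ ∷ xs) (r ∷ k)   l = r ∷ Linked-join (x′ ∷ xs) k l

Outside2 : ∀ {n} → Graph n → Fin n → Fin n → Fin n → Set
Outside2 G a b x = x ≢ a × x ≢ b

module _ {n : ℕ} {G : Graph n} where

  open DecMembership (_≟F_ {n}) using (_∈?_)

  infixr 5 _◅◅_

  _◅◅_ : ∀ {P x y z} → Reach G P x y → Reach G P y z → Reach G P x z
  here _     ◅◅ r′ = r′
  step p e r ◅◅ r′ = step p e (r ◅◅ r′)

  Reach-source : ∀ {P x y} → Reach G P x y → P x
  Reach-source (here p)     = p
  Reach-source (step p _ _) = p

  Reach-map : ∀ {P Q : Fin n → Set} → (∀ {z} → P z → Q z) → ∀ {x y} → Reach G P x y → Reach G Q x y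
  Reach-map f (here p)     = here (f p)
  Reach-map f (step p e r) = step (f p) e (Reach-map f r)

  Linked⇒Reach : ∀ {P x xs} → Linked (Adj G) (x ∷ xs) → All P (x ∷ xs) → All (Reach G P x) (x ∷ xs)
  Linked⇒Reach [-]     (p ∷ []) = here p ∷ []
  Linked⇒Reach (e ∷ l) (p ∷ ps) = here p ∷ All.map (step p e) (Linked⇒Reach l ps)

  data SimplePath (P : Fin n → Set) : Fin n → Fin n → List (Fin n) → Set where
    stop : ∀ {x} → P x → SimplePath P x x []
    cons : ∀ {x y z ts} → P x → Adj G x y → x ∉ y ∷ ts → SimplePath P y z ts → SimplePath P x z (y ∷ ts)

  shortcut : ∀ {P x y z ts} → SimplePath P y z ts → x ∈ y ∷ ts → ∃ (SimplePath P x z)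
  shortcut p                (here refl) = _ , p
  shortcut (cons _ _ _ p)   (there x∈)  = shortcut p x∈

  Reach⇒SimplePath : ∀ {P x z} → Reach G P x z → ∃ (SimplePath P x z)
  Reach⇒SimplePath (here p) = _ , stop p
  Reach⇒SimplePath (step {x} {y} p e r) with ts , path ← Reach⇒SimplePath r with x ∈? y ∷ ts
  ... | yes x∈ = shortcut path x∈
  ... | no  x∉ = _ , cons p e x∉ path

  SimplePath⇒Unique : ∀ {P x y ts} → SimplePath P x y ts → Unique (x ∷ ts)
  SimplePath⇒Unique (stop _)          = [] ∷ []
  SimplePath⇒Unique (cons _ _ x∉ p)  = ¬Any⇒All¬ _ x∉ ∷ SimplePath⇒Unique p

  SimplePath⇒All : ∀ {P x y ts} → SimplePath P x y ts → All P (x ∷ ts)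
  SimplePath⇒All (stop p)         = p ∷ []
  SimplePath⇒All (cons p _ _ path) = p ∷ SimplePath⇒All path

  SimplePath⇒Linked-++ : ∀ {P x y ts z zs} → SimplePath P x y ts → Adj G y z → Linked (Adj G) (z ∷ zs)
                       → Linked (Adj G) (x ∷ ts ++ z ∷ zs)
  SimplePath⇒Linked-++ (stop _)          e l = e ∷ l
  SimplePath⇒Linked-++ (cons _ e′ _ path) e l = e′ ∷ SimplePath⇒Linked-++ path e l

  twoEdges⇒HasCycle : ∀ {P X Y : Fin n → Set} → (∀ {z} → X z → Y z → ⊥)
    → (∀ {z} → X z → P z) → (∀ {z} → Y z → P z)
    → ∀ {x₁ x₂ y₁ y₂} → Reach G X x₁ x₂ → Reach G Y y₂ y₁ → Adj G x₁ y₁ → Adj G x₂ y₂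
    → ¬ (x₁ ≡ x₂ × y₁ ≡ y₂) → HasCycle G P
  twoEdges⇒HasCycle {P} {X} {Y} X∩Y=∅ X⊆P Y⊆P {x₁} {x₂} {y₁} {y₂} x₁⇝x₂ y₂⇝y₁ e₁ e₂ distinct
    with ta , pa ← Reach⇒SimplePath x₁⇝x₂ | tb , pb ← Reach⇒SimplePath y₂⇝y₁ =
    x₁ , ta ++ y₂ ∷ tb , long ta tb pa pb
       , Unique-++⁺ (SimplePath⇒Unique pa) (SimplePath⇒Unique pb) disjoint
       , All-++⁺ (All.map X⊆P (SimplePath⇒All pa)) (All.map Y⊆P (SimplePath⇒All pb))
       , subst (λ l → Linked (Adj G) (x₁ ∷ l)) (≡-sym (++-assoc ta (y₂ ∷ tb) [ x₁ ]))
           (SimplePath⇒Linked-++ pa e₂ (SimplePath⇒Linked-++ pb (sym G e₁) [-]))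
    where
    long : ∀ ta tb → SimplePath X x₁ x₂ ta → SimplePath Y y₂ y₁ tb → 2 ≤ length (ta ++ y₂ ∷ tb)
    long (_ ∷ [])    _       _        _        = s≤s (s≤s z≤n)
    long (_ ∷ _ ∷ _) _       _        _        = s≤s (s≤s z≤n)
    long []          (_ ∷ _) _        _        = s≤s (s≤s z≤n)
    long []          []      (stop _) (stop _) = ⊥-elim (distinct (refl , refl))

    disjoint : ∀ {z} → ¬ (z ∈ x₁ ∷ ta × z ∈ y₂ ∷ tb)
    disjoint (z∈a , z∈b) = X∩Y=∅ (All.lookup (SimplePath⇒All pa) z∈a) (All.lookup (SimplePath⇒All pb) z∈b)

IsCycle : ∀ {n} → Graph n → (Fin n → Set) → Fin n → List (Fin n) → Set
IsCycle G P x rest = (2 ≤ length rest) × Unique (x ∷ rest) × All P (x ∷ rest) × Linked (Adj G) (x ∷ rest ++ [ x ])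

IsCycle-rotate : ∀ {n} {G : Graph n} {P x} as {w} bs → IsCycle G P x (as ++ w ∷ bs) → IsCycle G P w (bs ++ x ∷ as)
IsCycle-rotate {n} {G} {P} {x} as {w} bs (long , unique , all , linked) =
  subst (2 ≤_) (suc-injective (↭-length π)) long ,
  Permutationₛ.Unique-resp-↭ (setoid (Fin n)) (↭⇒↭ₛ π) unique ,
  All-resp-↭ π all ,
  subst (λ l → Linked (Adj G) (w ∷ l)) (≡-sym (++-assoc bs (x ∷ as) [ w ]))
    (Linked-join (w ∷ bs) (proj₂ halves) (proj₁ halves))
  where
  π : x ∷ as ++ w ∷ bs ↭ w ∷ bs ++ x ∷ as
  π = ++-comm (x ∷ as) (w ∷ bs)

  halves : Linked (Adj G) ((x ∷ as) ∷ʳ w) × Linked (Adj G) (w ∷ bs ∷ʳ x)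
  halves = Linked-split (x ∷ as) (subst (λ l → Linked (Adj G) (x ∷ l)) (++-assoc as (w ∷ bs) [ x ]) linked)

PendantTrees : ∀ {n} → Graph n → Fin n → Fin n → Fin n → Set
PendantTrees G u v w = ∀ x → Outside3 G u v w x →
  IsTree G (Component3 G u v w x)
  × (∃ λ y → Component3 G u v w x y × Adj G w y
       × (∀ z → Component3 G u v w x z → Adj G w z → z ≡ y))

module _ {n : ℕ} {G : Graph n} {u v w : Fin n} (pendant : PendantTrees G u v w) where

  open DecMembership (_≟F_ {n}) using (_∈?_)

  neighbours-disconnected : ∀ {y z} → Adj G w y → Adj G w z → y ≢ z → ¬ Reach G (Outside3 G u v w) y z
  neighbours-disconnected wy wz y≢z y⇝z with _ , (_ , _ , _ , unique) ← pendant _ (Reach-source y⇝z) =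
    y≢z (trans (unique _ (here (Reach-source y⇝z)) wy) (≡-sym (unique _ y⇝z wz)))

  outside-w : ∀ {z} → Outside2 G u v z × w ≢ z → Outside3 G u v w z
  outside-w ((z≢u , z≢v) , w≢z) = z≢u , z≢v , ≢-sym w≢z

  cycle-avoiding-w : ∀ {x rest} → IsCycle G (Outside2 G u v) x rest → w ∉ x ∷ rest → ⊥
  cycle-avoiding-w {x} {rest} (long , unique , all , linked) w∉ =
    acyclic (x , rest , long , unique , inComponent , linked)
    where
    outside : All (Outside3 G u v w) (x ∷ rest)
    outside = All.zipWith outside-w (all , ¬Any⇒All¬ _ w∉)

    inComponent : All (Component3 G u v w x) (x ∷ rest)
    inComponent = All-++⁻ˡ (x ∷ rest) (Linked⇒Reach linked (All-++⁺ outside (All.head outside ∷ [])))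

    acyclic : ¬ HasCycle G (Component3 G u v w x)
    acyclic = proj₂ (proj₂ (proj₁ (pendant x (All.head outside))))

  cycle-through-w : ∀ {rest} → IsCycle G (Outside2 G u v) w rest → ⊥
  cycle-through-w {[]}     (() , _)
  cycle-through-w {r ∷ ts} cycle with initLast ts
  cycle-through-w {r ∷ _} (s≤s () , _) | []
  cycle-through-w {r ∷ _} (_ , (w∉ ∷ r∉ ∷ _) , (_ ∷ all) , (wr ∷ linked)) | ms ∷ʳ′ s =
    neighbours-disconnected wr (Graph.sym G (Linked.head (proj₂ halves))) r≢s
      (All.lookup (Linked⇒Reach (proj₁ halves) outside) (there s∈))
    where
    s∈ : s ∈ ms ∷ʳ s
    s∈ = ∈-++⁺ʳ ms (here refl)

    r≢s : r ≢ s
    r≢s = All.lookup r∉ s∈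

    halves : Linked (Adj G) (r ∷ ms ∷ʳ s) × Linked (Adj G) (s ∷ w ∷ [])
    halves = Linked-split (r ∷ ms) (subst (Linked (Adj G)) (++-assoc (r ∷ ms) [ s ] [ w ]) linked)

    outside : All (Outside3 G u v w) (r ∷ ms ∷ʳ s)
    outside = All.zipWith outside-w (all , w∉)

  PendantTrees⇒Acyclic : ¬ HasCycle G (Outside2 G u v)
  PendantTrees⇒Acyclic (x , rest , cycle) with w ∈? x ∷ rest
  ... | no  w∉          = cycle-avoiding-w cycle w∉
  ... | yes (here refl) = cycle-through-w cycle
  ... | yes (there w∈) with as , bs , refl ← ∈-∃++ w∈ = cycle-through-w (IsCycle-rotate {G = G} as bs cycle)

-- p lies on a cycle of H − {a, b}.
record CycleAvoiding {k} (H : Graph k) (a b : Fin k) : Set where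
  constructor cycleAvoiding
  field
    p q s   : Fin k
    p∉ab    : Outside2 H a b p
    p~q     : Adj H p q
    p~s     : Adj H p s
    q≢s     : q ≢ s
    s⇝q     : Reach H (Outside3 H a b p) s q

module _ {n k : ℕ} {G : Graph n} {H : Graph k} (M : MinorModel G H) where

  Branches : (Fin k → Set) → Fin n → Set
  Branches S x = ∃ λ c → φ M x ≡ just c × S c

  branches-apart : ∀ {x y c d} → φ M x ≡ just c → φ M y ≡ just d → c ≢ d → x ≢ y
  branches-apart x∈c y∈d c≢d refl = c≢d (just-injective (trans (≡-sym x∈c) y∈d))

  Reach-lift : ∀ {S c d x y} → Reach H S c d → φ M x ≡ just c → φ M y ≡ just d → Reach G (Branches S) x y
  Reach-lift (here Sc) x∈c y∈c = Reach-map (λ z∈c → _ , z∈c , Sc) (connected M _ _ _ x∈c y∈c)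
  Reach-lift (step Sc c~c′ c′⇝d) x∈c y∈d with x′ , y′ , x′~y′ , x′∈c , y′∈c′ ← edges M _ _ c~c′ =
    Reach-map (λ z∈c → _ , z∈c , Sc) (connected M _ _ _ x∈c x′∈c)
      ◅◅ step (_ , x′∈c , Sc) x′~y′ (Reach-lift c′⇝d y′∈c′ y∈d)

  CycleAvoiding⇒HasCycle : ∀ {u v a b} → φ M u ≡ just a → φ M v ≡ just b → CycleAvoiding H a b
                         → HasCycle G (Outside2 G u v)
  CycleAvoiding⇒HasCycle {u} {v} {a} {b} u∈a v∈b (cycleAvoiding p q s (p≢a , p≢b) p~q p~s q≢s s⇝q)
    with x₁ , y₁ , x₁~y₁ , x₁∈p , y₁∈q ← edges M p q p~q
       | x₂ , y₂ , x₂~y₂ , x₂∈p , y₂∈s ← edges M p s p~s =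
    twoEdges⇒HasCycle disjoint X⊆ Y⊆ (connected M p _ _ x₁∈p x₂∈p) (Reach-lift s⇝q y₂∈s y₁∈q) x₁~y₁ x₂~y₂
      (λ (_ , y₁≡y₂) → branches-apart y₁∈q y₂∈s q≢s y₁≡y₂)
    where
    disjoint : ∀ {z} → φ M z ≡ just p → Branches (Outside3 H a b p) z → ⊥
    disjoint z∈p (_ , z∈c , _ , _ , c≢p) = branches-apart z∈c z∈p c≢p refl

    X⊆ : ∀ {z} → φ M z ≡ just p → Outside2 G u v z
    X⊆ z∈p = branches-apart z∈p u∈a p≢a , branches-apart z∈p v∈b p≢b

    Y⊆ : ∀ {z} → Branches (Outside3 H a b p) z → Outside2 G u v z
    Y⊆ (_ , z∈c , c≢a , c≢b , _) = branches-apart z∈c u∈a c≢a , branches-apart z∈c v∈b c≢b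

prismAdj? : (i j : Fin 6) → Dec (PrismAdj i j)
prismAdj? i j = anyᴸ? (λ e → ≡-dec _≟ℕ_ _≟ℕ_ e (toℕ i , toℕ j)) prismEdges
          ⊎-dec anyᴸ? (λ e → ≡-dec _≟ℕ_ _≟ℕ_ e (toℕ j , toℕ i)) prismEdges

-- CycleAvoiding Prism a b with a path from s to q of at most one inner vertex,
-- spelled out so that it is decidable.
ShortCycleAvoiding : Fin 6 → Fin 6 → Set
ShortCycleAvoiding a b = ∃ λ p → ∃ λ q → ∃ λ s →
  Outside2 Prism a b p × PrismAdj p q × PrismAdj p s × q ≢ s
  × Outside3 Prism a b p s × Outside3 Prism a b p q
  × (PrismAdj s q ⊎ ∃ λ r → Outside3 Prism a b p r × PrismAdj s r × PrismAdj r q)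

shortCycleAvoiding? : ∀ a b → Dec (ShortCycleAvoiding a b)
shortCycleAvoiding? a b = any? λ p → any? λ q → any? λ s →
  (¬? (p ≟F a) ×-dec ¬? (p ≟F b)) ×-dec prismAdj? p q ×-dec prismAdj? p s ×-dec ¬? (q ≟F s)
  ×-dec outside? p s ×-dec outside? p q
  ×-dec (prismAdj? s q ⊎-dec any? λ r → outside? p r ×-dec prismAdj? s r ×-dec prismAdj? r q)
  where
  outside? : ∀ p c → Dec (Outside3 Prism a b p c)
  outside? p c = ¬? (c ≟F a) ×-dec ¬? (c ≟F b) ×-dec ¬? (c ≟F p)

ShortCycleAvoiding⇒CycleAvoiding : ∀ {a b} → ShortCycleAvoiding a b → CycleAvoiding Prism a b
ShortCycleAvoiding⇒CycleAvoiding (p , q , s , p∉ab , p~q , p~s , q≢s , s∉ , q∉ , inj₁ s~q) =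
  cycleAvoiding p q s p∉ab p~q p~s q≢s (step s∉ s~q (here q∉))
ShortCycleAvoiding⇒CycleAvoiding (p , q , s , p∉ab , p~q , p~s , q≢s , s∉ , q∉ , inj₂ (r , r∉ , s~r , r~q)) =
  cycleAvoiding p q s p∉ab p~q p~s q≢s (step s∉ s~r (step r∉ r~q (here q∉)))

prism-cycleAvoiding : ∀ a b → PrismAdj a b → CycleAvoiding Prism a b
prism-cycleAvoiding a b a~b = ShortCycleAvoiding⇒CycleAvoiding (checked a b a~b)
  where
  -- Exhaustive check over all pairs of prism vertices, run by the type checker.
  checked : ∀ a b → PrismAdj a b → ShortCycleAvoiding a b
  checked = toWitness {a? = all? λ a → all? λ b → prismAdj? a b →-dec shortCycleAvoiding? a b} _

lemma6p3 : ∀ {n : ℕ} (G : Graph n) → ThreeConnected G → 6 ≤ n →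
    (u v w : Fin n) → Adj G u v → VertexCut3 G u v w →
    (∀ x → Outside3 G u v w x →
      IsTree G (Component3 G u v w x)
      × (∃ λ y → Component3 G u v w x y × Adj G w y
           × (∀ z → Component3 G u v w x z → Adj G w z → z ≡ y))) →
    ¬ HasPrismMinorUsing G u v
lemma6p3 G _ _ u v w _ _ pendant (M , a , b , a~b , u∈a , v∈b) =
  PendantTrees⇒Acyclic pendant (CycleAvoiding⇒HasCycle M u∈a v∈b (prism-cycleAvoiding a b a~b))
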